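{- Let $0<q<1$, $\lambda\in\mathbb{C}$ with $\lambda\neq 1$, and $n\ge0$. Let $p(x)\in\mathbb{C}[x]$ be a polynomial of degree at most $n$, and write $p(x)=\sum_{k=0}^{n}C_kH_{k,q}(x\mid\lambda)$ with $C_k\in\mathbb{C}$. Then for $0\le k\le n$, $$C_k=\frac{1}{[k]_q!\,(1-\lambda)}\Big\{p^{(k)}(1)-\lambda\,p^{(k)}(0)\Big\},$$ where $p^{(k)}(x)=D_q^kp(x)$.
   Context: For a number $x$, $[x]_q=\frac{1-q^{x}}{1-q}$; $[0]_q!=1$ and $[n]_q!=[n]_q\cdots[1]_q$. The $q$-exponential is $e_q(z)=\sum_{n\ge0}\frac{z^n}{[n]_q!}$. The $q$-derivative is $D_qf(x)=\frac{f(x)-f(qx)}{(1-q)x}$, so $D_qx^n=[n]_qx^{n-1}$, and $D_q^k$ is its $k$-fold iterate. The $q$-Frobenius–Euler polynomials $H_{n,q}(x\mid\lambda)$ (with $\deg H_{n,q}=n$) are defined by $\frac{1-\lambda}{e_q(t)-\lambda}e_q(xt)=\sum_{n\ge0}H_{n,q}(x\mid\lambda)\frac{t^n}{[n]_q!}$ as formal power series in $t$. -}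

module Defs where

open import Level using (Level)
open import Data.Nat as ℕ using (ℕ; zero; suc; _∸_)
open import Relation.Nullary using (yes; no)
open import Algebra.Bundles using (CommutativeRing)

module _ {c ℓ : Level} (R : CommutativeRing c ℓ) where
  open CommutativeRing R renaming (Carrier to K)

  sumTo : (ℕ → K) → ℕ → K
  sumTo f zero    = 0#
  sumTo f (suc n) = sumTo f n + f n

  pow : K → ℕ → K
  pow x zero    = 1#
  pow x (suc n) = pow x n * x

  -- [n]_q = (1 - q^n)/(1 - q) = 1 + q + ... + q^(n-1)
  qint : K → ℕ → K
  qint q n = sumTo (pow q) n

  qfact : K → ℕ → K
  qfact q zero    = 1#
  qfact q (suc n) = qfact q n * qint q (suc n)

  -- 1/[n]_q ! built from given inverses  qinv m = 1/[m+1]_q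
  qfactInv : (ℕ → K) → ℕ → K
  qfactInv qinv zero    = 1#
  qfactInv qinv (suc n) = qfactInv qinv n * qinv n

  -- polynomials in K[x] as coefficient sequences  (p i = coefficient of x^i)
  Poly : Set c
  Poly = ℕ → K

  DegLe : Poly → ℕ → Set ℓ
  DegLe p n = ∀ m → n ℕ.< m → p m ≈ 0#

  evalDeg : Poly → ℕ → K → K
  evalDeg p n x = sumTo (λ i → p i * pow x i) (suc n)

  -- q-derivative on coefficients: D_q x^(i+1) = [i+1]_q x^i
  Dq : K → Poly → Poly
  Dq q p i = qint q (suc i) * p (suc i)

  Dqⁿ : K → ℕ → Poly → Poly
  Dqⁿ q zero    p = p
  Dqⁿ q (suc k) p = Dq q (Dqⁿ q k p)

  -- coefficient of t^j in  e_q(t) - λ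
  eqMinus : (ℕ → K) → K → ℕ → K
  eqMinus qinv λ' zero    = 1# - λ'
  eqMinus qinv λ' (suc j) = qfactInv qinv (suc j)

  -- coefficient of x^i t^m in e_q(x t) = Σ x^m t^m / [m]_q!
  eqxt : (ℕ → K) → ℕ → ℕ → K
  eqxt qinv m i with m ℕ.≟ i
  ... | yes _ = qfactInv qinv m
  ... | no  _ = 0#

  -- H is the family of q-Frobenius–Euler polynomials H_{m,q}(x|λ):
  --   (1-λ)/(e_q(t)-λ) e_q(xt) = Σ_m H m t^m/[m]_q!,
  -- stated (as e_q(t)-λ is invertible) as the coefficientwise identity
  --   (e_q(t)-λ) · Σ_m H m t^m/[m]_q! = (1-λ) e_q(xt)
  -- for the coefficient of x^i t^m.
  IsFrobeniusEuler : (ℕ → K) → K → (ℕ → Poly) → Set ℓ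
  IsFrobeniusEuler qinv λ' H =
    ∀ m i → sumTo (λ j → eqMinus qinv λ' j * (H (m ∸ j) i * qfactInv qinv (m ∸ j))) (suc m)
            ≈ (1# - λ') * eqxt qinv m i

-- The functional  L P = (D_q^k P)(1) − λ (D_q^k P)(0)  is linear, so L p = Σ_j C_j L(H_j).
-- Applying L to the generating-function identity  (e_q(t) − λ) Σ_m H_m t^m/[m]! = (1 − λ) e_q(xt)
-- coefficientwise in t^m shows that the sequence L(H_j)/[j]! has the same convolution with the
-- coefficients of e_q(t) − λ as the sequence (1 − λ) δ_{jk}.  That convolution is injective, the
-- constant coefficient 1 − λ being a unit, so L(H_j) = [j]! (1 − λ) δ_{jk}, whence L p = C_k [k]! (1 − λ).
module Submission where

open import Defs
open import Level using (Level)
open import Data.Nat using (ℕ; suc; _≤_)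
open import Algebra.Bundles using (CommutativeRing)

open import Data.Nat as ℕ using (zero; _<_; _∸_; z≤n; s≤s; z<s)
open import Data.Nat.Properties as ℕₚ using ()
open import Data.Nat.Induction using (<-rec)
open import Data.Sum using (inj₁; inj₂)
open import Data.Empty using (⊥-elim)
open import Relation.Nullary using (yes; no)
open import Relation.Binary.PropositionalEquality as ≡ using (_≢_)
import Relation.Binary.Reasoning.Setoid as SetoidReasoning
import Algebra.Properties.AbelianGroup as AbelianGroupProperties
import Algebra.Properties.Ring as RingProperties

module FiniteSums {c ℓ : Level} (R : CommutativeRing c ℓ) where
  open CommutativeRing R renaming (Carrier to K)
  open SetoidReasoning setoid
  open import Algebra.Properties.CommutativeSemigroup +-commutativeSemigroup using (interchange)
  open AbelianGroupProperties +-abelianGroup using (⁻¹-∙-comm)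

  ∑ : (ℕ → K) → ℕ → K
  ∑ = sumTo R

  sumTo-cong : ∀ {f g} N → (∀ i → i < N → f i ≈ g i) → ∑ f N ≈ ∑ g N
  sumTo-cong zero    f≈g = refl
  sumTo-cong (suc N) f≈g =
    +-cong (sumTo-cong N (λ i i<N → f≈g i (ℕₚ.m<n⇒m<1+n i<N))) (f≈g N (ℕₚ.n<1+n N))

  sumTo-cong′ : ∀ {f g} N → (∀ i → f i ≈ g i) → ∑ f N ≈ ∑ g N
  sumTo-cong′ N f≈g = sumTo-cong N (λ i _ → f≈g i)

  sumTo-zero : ∀ f N → (∀ i → i < N → f i ≈ 0#) → ∑ f N ≈ 0#
  sumTo-zero f zero    f≈0 = refl
  sumTo-zero f (suc N) f≈0 =
    trans (+-cong (sumTo-zero f N (λ i i<N → f≈0 i (ℕₚ.m<n⇒m<1+n i<N))) (f≈0 N (ℕₚ.n<1+n N)))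
          (+-identityˡ 0#)

  sumTo-single : ∀ f N t → t < N → (∀ i → i < N → i ≢ t → f i ≈ 0#) → ∑ f N ≈ f t
  sumTo-single f (suc N) t t<1+N f≈0 with t ℕ.≟ N
  ... | yes ≡.refl =
    trans (+-cong (sumTo-zero f N (λ i i<N → f≈0 i (ℕₚ.m<n⇒m<1+n i<N) (ℕₚ.<⇒≢ i<N))) refl)
          (+-identityˡ (f t))
  ... | no t≢N =
    trans (+-cong (sumTo-single f N t (ℕₚ.≤∧≢⇒< (ℕₚ.m<1+n⇒m≤n t<1+N) t≢N)
                                (λ i i<N → f≈0 i (ℕₚ.m<n⇒m<1+n i<N)))
                  (f≈0 N (ℕₚ.n<1+n N) (λ N≡t → t≢N (≡.sym N≡t))))
          (+-identityʳ (f t))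

  sumTo-+ : ∀ f g N → ∑ (λ i → f i + g i) N ≈ ∑ f N + ∑ g N
  sumTo-+ f g zero    = sym (+-identityˡ 0#)
  sumTo-+ f g (suc N) = begin
    ∑ (λ i → f i + g i) N + (f N + g N) ≈⟨ +-cong (sumTo-+ f g N) refl ⟩
    (∑ f N + ∑ g N) + (f N + g N)       ≈⟨ interchange _ _ _ _ ⟩
    (∑ f N + f N) + (∑ g N + g N)       ∎

  sumTo-- : ∀ f g N → ∑ (λ i → f i - g i) N ≈ ∑ f N - ∑ g N
  sumTo-- f g zero    = sym (-‿inverseʳ 0#)
  sumTo-- f g (suc N) = begin
    ∑ (λ i → f i - g i) N + (f N - g N) ≈⟨ +-cong (sumTo-- f g N) refl ⟩
    (∑ f N - ∑ g N) + (f N - g N)       ≈⟨ interchange _ _ _ _ ⟩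
    (∑ f N + f N) + (- ∑ g N - g N)     ≈⟨ +-cong refl (⁻¹-∙-comm _ _) ⟩
    (∑ f N + f N) - (∑ g N + g N)       ∎

  sumTo-*ˡ : ∀ a f N → ∑ (λ i → a * f i) N ≈ a * ∑ f N
  sumTo-*ˡ a f zero    = sym (zeroʳ a)
  sumTo-*ˡ a f (suc N) = trans (+-cong (sumTo-*ˡ a f N) refl) (sym (distribˡ a (∑ f N) (f N)))

  sumTo-*ʳ : ∀ a f N → ∑ (λ i → f i * a) N ≈ ∑ f N * a
  sumTo-*ʳ a f zero    = sym (zeroˡ a)
  sumTo-*ʳ a f (suc N) = trans (+-cong (sumTo-*ʳ a f N) refl) (sym (distribʳ a (∑ f N) (f N)))

  sumTo-comm : ∀ (g : ℕ → ℕ → K) N M → ∑ (λ i → ∑ (g i) M) N ≈ ∑ (λ j → ∑ (λ i → g i j) N) M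
  sumTo-comm g zero    M = sym (sumTo-zero (λ _ → 0#) M (λ _ _ → refl))
  sumTo-comm g (suc N) M = begin
    ∑ (λ i → ∑ (g i) M) N + ∑ (g N) M             ≈⟨ +-cong (sumTo-comm g N M) refl ⟩
    ∑ (λ j → ∑ (λ i → g i j) N) M + ∑ (g N) M     ≈⟨ sumTo-+ (λ j → ∑ (λ i → g i j) N) (g N) M ⟨
    ∑ (λ j → ∑ (λ i → g i j) (suc N)) M           ∎

  sumTo-unfoldˡ : ∀ f N → ∑ f (suc N) ≈ f 0 + ∑ (λ i → f (suc i)) N
  sumTo-unfoldˡ f zero    = trans (+-identityˡ (f 0)) (sym (+-identityʳ (f 0)))
  sumTo-unfoldˡ f (suc N) = trans (+-cong (sumTo-unfoldˡ f N) refl) (+-assoc (f 0) _ _)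

module Units {c ℓ : Level} (R : CommutativeRing c ℓ) where
  open CommutativeRing R renaming (Carrier to K)
  open SetoidReasoning setoid
  open import Algebra.Properties.CommutativeSemigroup *-commutativeSemigroup using (interchange; x∙yz≈y∙xz)

  unit-*-cancelˡ : ∀ {u a x y} → u * a ≈ 1# → a * x ≈ a * y → x ≈ y
  unit-*-cancelˡ {u} {a} {x} {y} ua≈1 ax≈ay = begin
    x             ≈⟨ *-identityˡ x ⟨
    1# * x        ≈⟨ *-cong ua≈1 refl ⟨
    (u * a) * x   ≈⟨ *-assoc u a x ⟩
    u * (a * x)   ≈⟨ *-cong refl ax≈ay ⟩
    u * (a * y)   ≈⟨ *-assoc u a y ⟨
    (u * a) * y   ≈⟨ *-cong ua≈1 refl ⟩
    1# * y        ≈⟨ *-identityˡ y ⟩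
    y             ∎

  units-cancel : ∀ {a a′ b b′} x → a′ * a ≈ 1# → b * b′ ≈ 1# → x ≈ (a * b) * (x * (a′ * b′))
  units-cancel {a} {a′} {b} {b′} x a′a≈1 bb′≈1 = begin
    x                              ≈⟨ *-identityʳ x ⟨
    x * 1#                         ≈⟨ *-cong refl (*-identityʳ 1#) ⟨
    x * (1# * 1#)                  ≈⟨ *-cong refl (*-cong a′a≈1 bb′≈1) ⟨
    x * ((a′ * a) * (b * b′))      ≈⟨ *-cong refl (*-cong (*-comm a′ a) refl) ⟩
    x * ((a * a′) * (b * b′))      ≈⟨ *-cong refl (interchange a b a′ b′) ⟨
    x * ((a * b) * (a′ * b′))      ≈⟨ x∙yz≈y∙xz (a * b) x (a′ * b′) ⟨
    (a * b) * (x * (a′ * b′))      ∎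

module Convolution {c ℓ : Level} (R : CommutativeRing c ℓ) where
  open CommutativeRing R renaming (Carrier to K)
  open SetoidReasoning setoid
  open FiniteSums R
  open Units R using (unit-*-cancelˡ)
  open AbelianGroupProperties +-abelianGroup using (∙-cancelʳ)

  δ : ℕ → ℕ → K
  δ i j with i ℕ.≟ j
  ... | yes _ = 1#
  ... | no  _ = 0#

  δ-diag : ∀ i → δ i i ≈ 1#
  δ-diag i with i ℕ.≟ i
  ... | yes _   = refl
  ... | no  i≢i = ⊥-elim (i≢i ≡.refl)

  δ-offdiag : ∀ {i j} → i ≢ j → δ i j ≈ 0#
  δ-offdiag {i} {j} i≢j with i ℕ.≟ j
  ... | yes i≡j = ⊥-elim (i≢j i≡j)
  ... | no  _   = refl

  conv : (ℕ → K) → (ℕ → K) → ℕ → K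
  conv E A m = ∑ (λ l → E l * A (m ∸ l)) (suc m)

  conv-injective : ∀ {u E A B} → u * E 0 ≈ 1# → ∀ n →
                   (∀ m → m ≤ n → conv E A m ≈ conv E B m) → ∀ m → m ≤ n → A m ≈ B m
  conv-injective {u} {E} {A} {B} unit n agree = <-rec (λ m → m ≤ n → A m ≈ B m) step
    where
    step : ∀ m → (∀ {j} → j < m → j ≤ n → A j ≈ B j) → m ≤ n → A m ≈ B m
    step m A≈B-below m≤n = unit-*-cancelˡ unit (∙-cancelʳ (tail B) _ _ (begin
      E 0 * A m + tail B   ≈⟨ +-cong refl tails-agree ⟨
      E 0 * A m + tail A   ≈⟨ sumTo-unfoldˡ _ m ⟨
      conv E A m           ≈⟨ agree m m≤n ⟩
      conv E B m           ≈⟨ sumTo-unfoldˡ _ m ⟩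
      E 0 * B m + tail B   ∎))
      where
      tail : (ℕ → K) → K
      tail F = ∑ (λ l → E (suc l) * F (m ∸ suc l)) m

      tails-agree : tail A ≈ tail B
      tails-agree = sumTo-cong m (λ l l<m → *-cong refl
        (A≈B-below (ℕₚ.∸-monoʳ-< z<s l<m) (ℕₚ.≤-trans (ℕₚ.m∸n≤m m (suc l)) m≤n)))

  conv-δ-below : ∀ E a {m k} → m < k → conv E (λ j → δ j k * a) m ≈ 0#
  conv-δ-below E a {m} m<k = sumTo-zero _ (suc m) (λ l _ →
    trans (*-cong refl (trans (*-cong (δ-offdiag (ℕₚ.<⇒≢ (ℕₚ.≤-<-trans (ℕₚ.m∸n≤m m l) m<k))) refl)
                              (zeroˡ a)))
          (zeroʳ (E l)))

  conv-δ-shift : ∀ E a r k → conv E (λ j → δ j k * a) (r ℕ.+ k) ≈ E r * a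
  conv-δ-shift E a r k = trans (sumTo-single _ (suc (r ℕ.+ k)) r (s≤s (ℕₚ.m≤m+n r k)) off-support) (begin
    E r * (δ ((r ℕ.+ k) ∸ r) k * a)   ≡⟨ ≡.cong (λ j → E r * (δ j k * a)) (ℕₚ.m+n∸m≡n r k) ⟩
    E r * (δ k k * a)                 ≈⟨ *-cong refl (trans (*-cong (δ-diag k) refl) (*-identityˡ a)) ⟩
    E r * a                           ∎)
    where
    off-support : ∀ l → l < suc (r ℕ.+ k) → l ≢ r → E l * (δ ((r ℕ.+ k) ∸ l) k * a) ≈ 0#
    off-support l (s≤s l≤r+k) l≢r = trans (*-cong refl (trans (*-cong (δ-offdiag r+k∸l≢k) refl) (zeroˡ a)))
                                          (zeroʳ (E l))
      where
      r+k∸l≢k : (r ℕ.+ k) ∸ l ≢ k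
      r+k∸l≢k r+k∸l≡k = l≢r (ℕₚ.+-cancelʳ-≡ k l r (≡.trans (ℕₚ.+-comm l k)
        (≡.trans (≡.cong (ℕ._+ l) (≡.sym r+k∸l≡k)) (ℕₚ.m∸n+n≡m l≤r+k))))

module QCalculus {c ℓ : Level} (R : CommutativeRing c ℓ) where
  open CommutativeRing R renaming (Carrier to K)
  open SetoidReasoning setoid
  open FiniteSums R
  open import Algebra.Properties.CommutativeSemigroup *-commutativeSemigroup
    using (interchange; x∙yz≈y∙xz; x∙yz≈y∙zx)

  qfall : K → ℕ → ℕ → K
  qfall q zero    i = 1#
  qfall q (suc k) i = qint R q (suc i) * qfall q k (suc i)

  Dqⁿ-coeff : ∀ q k (P : Poly R) i → Dqⁿ R q k P i ≈ qfall q k i * P (i ℕ.+ k)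
  Dqⁿ-coeff q zero    P i = sym (trans (*-identityˡ _) (reflexive (≡.cong P (ℕₚ.+-identityʳ i))))
  Dqⁿ-coeff q (suc k) P i = begin
    [i+1] * Dqⁿ R q k P (suc i)                   ≈⟨ *-cong refl (Dqⁿ-coeff q k P (suc i)) ⟩
    [i+1] * (qfall q k (suc i) * P (suc i ℕ.+ k)) ≈⟨ *-assoc _ _ _ ⟨
    qfall q (suc k) i * P (suc i ℕ.+ k)           ≡⟨ ≡.cong (λ j → qfall q (suc k) i * P j) (ℕₚ.+-suc i k) ⟨
    qfall q (suc k) i * P (i ℕ.+ suc k)           ∎
    where [i+1] = qint R q (suc i)

  module Inverses (q : K) (qinv : ℕ → K) (qinv-inverse : ∀ m → qinv m * qint R q (suc m) ≈ 1#) where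

    qfact-*-qfactInv : ∀ j → qfact R q j * qfactInv R qinv j ≈ 1#
    qfact-*-qfactInv zero    = *-identityˡ 1#
    qfact-*-qfactInv (suc j) = begin
      (qfact R q j * [j+1]) * (qfactInv R qinv j * qinv j)   ≈⟨ interchange _ _ _ _ ⟩
      (qfact R q j * qfactInv R qinv j) * ([j+1] * qinv j)   ≈⟨ *-cong (qfact-*-qfactInv j) (*-comm _ _) ⟩
      1# * (qinv j * [j+1])                                  ≈⟨ *-cong refl (qinv-inverse j) ⟩
      1# * 1#                                                ≈⟨ *-identityˡ 1# ⟩
      1#                                                     ∎
      where [j+1] = qint R q (suc j)

    qfactInv-*-qfall : ∀ k r → qfactInv R qinv (r ℕ.+ k) * qfall q k r ≈ qfactInv R qinv r
    qfactInv-*-qfall zero    r = trans (*-identityʳ _) (reflexive (≡.cong (qfactInv R qinv) (ℕₚ.+-identityʳ r)))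
    qfactInv-*-qfall (suc k) r = begin
      qfactInv R qinv (r ℕ.+ suc k) * ([r+1] * qfall q k (suc r))
        ≡⟨ ≡.cong (λ j → qfactInv R qinv j * ([r+1] * qfall q k (suc r))) (ℕₚ.+-suc r k) ⟩
      qfactInv R qinv (suc r ℕ.+ k) * ([r+1] * qfall q k (suc r))  ≈⟨ x∙yz≈y∙xz _ _ _ ⟩
      [r+1] * (qfactInv R qinv (suc r ℕ.+ k) * qfall q k (suc r))  ≈⟨ *-cong refl (qfactInv-*-qfall k (suc r)) ⟩
      [r+1] * (qfactInv R qinv r * qinv r)                         ≈⟨ x∙yz≈y∙zx _ _ _ ⟩
      qfactInv R qinv r * (qinv r * [r+1])                         ≈⟨ *-cong refl (qinv-inverse r) ⟩
      qfactInv R qinv r * 1#                                       ≈⟨ *-identityʳ _ ⟩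
      qfactInv R qinv r                                            ∎
      where [r+1] = qint R q (suc r)

  pow-one : ∀ i → pow R 1# i ≈ 1#
  pow-one zero    = refl
  pow-one (suc i) = trans (*-cong (pow-one i) refl) (*-identityˡ 1#)

  evalDeg-one : ∀ P n → evalDeg R P n 1# ≈ ∑ P (suc n)
  evalDeg-one P n = sumTo-cong′ (suc n) (λ i → trans (*-cong refl (pow-one i)) (*-identityʳ (P i)))

  evalDeg-zero : ∀ P n → evalDeg R P n 0# ≈ P 0
  evalDeg-zero P n = trans (sumTo-single _ (suc n) 0 (s≤s z≤n) higher-terms) (*-identityʳ (P 0))
    where
    higher-terms : ∀ i → i < suc n → i ≢ 0 → P i * pow R 0# i ≈ 0#
    higher-terms zero    _ 0≢0 = ⊥-elim (0≢0 ≡.refl)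
    higher-terms (suc i) _ _   = trans (*-cong refl (zeroʳ _)) (zeroʳ (P (suc i)))

  IsLinearCombination : Poly R → (ℕ → K) → (ℕ → Poly R) → ℕ → Set ℓ
  IsLinearCombination P a G M = ∀ i → P i ≈ ∑ (λ l → a l * G l i) M

  Dqⁿ-linear : ∀ q k P a G M → IsLinearCombination P a G M →
               IsLinearCombination (Dqⁿ R q k P) a (λ l → Dqⁿ R q k (G l)) M
  Dqⁿ-linear q zero    P a G M P≈ i = P≈ i
  Dqⁿ-linear q (suc k) P a G M P≈ i = begin
    [i+1] * Dqⁿ R q k P (suc i)                              ≈⟨ *-cong refl (Dqⁿ-linear q k P a G M P≈ (suc i)) ⟩
    [i+1] * ∑ (λ l → a l * Dqⁿ R q k (G l) (suc i)) M        ≈⟨ sumTo-*ˡ [i+1] _ M ⟨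
    ∑ (λ l → [i+1] * (a l * Dqⁿ R q k (G l) (suc i))) M      ≈⟨ sumTo-cong′ M (λ l → x∙yz≈y∙xz _ _ _) ⟩
    ∑ (λ l → a l * ([i+1] * Dqⁿ R q k (G l) (suc i))) M      ∎
    where [i+1] = qint R q (suc i)

  evalDeg-linear : ∀ P a G M n x → IsLinearCombination P a G M →
                   evalDeg R P n x ≈ ∑ (λ l → a l * evalDeg R (G l) n x) M
  evalDeg-linear P a G M n x P≈ = begin
    ∑ (λ i → P i * pow R x i) (suc n)                                ≈⟨ sumTo-cong′ (suc n) (λ i → *-cong (P≈ i) refl) ⟩
    ∑ (λ i → ∑ (λ l → a l * G l i) M * pow R x i) (suc n)            ≈⟨ sumTo-cong′ (suc n) (λ i → sumTo-*ʳ _ _ M) ⟨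
    ∑ (λ i → ∑ (λ l → (a l * G l i) * pow R x i) M) (suc n)          ≈⟨ sumTo-comm (λ i l → (a l * G l i) * pow R x i) (suc n) M ⟩
    ∑ (λ l → ∑ (λ i → (a l * G l i) * pow R x i) (suc n)) M          ≈⟨ sumTo-cong′ M (λ l → trans (sumTo-cong′ (suc n) (λ i → *-assoc _ _ _))
                                                                                                    (sumTo-*ˡ (a l) _ (suc n))) ⟩
    ∑ (λ l → a l * evalDeg R (G l) n x) M                            ∎

module FrobeniusEuler {c ℓ : Level} (R : CommutativeRing c ℓ) where
  open CommutativeRing R renaming (Carrier to K)
  open SetoidReasoning setoid
  open RingProperties ring using (x[y-z]≈xy-xz; [y-z]x≈yx-zx)
  open AbelianGroupProperties +-abelianGroup using (ε⁻¹≈ε)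
  open import Algebra.Properties.CommutativeSemigroup *-commutativeSemigroup using (x∙yz≈y∙xz)
  open FiniteSums R
  open Convolution R
  open QCalculus R

  module Expansion
    (q : K) (qinv : ℕ → K) (qinv-inverse : ∀ m → qinv m * qint R q (suc m) ≈ 1#)
    (λ' u : K) (u-inverse : u * (1# - λ') ≈ 1#)
    (H : ℕ → Poly R) (H-FE : IsFrobeniusEuler R qinv λ' H)
    (n k : ℕ) where

    open Inverses q qinv qinv-inverse

    μ : K
    μ = 1# - λ'

    E : ℕ → K
    E = eqMinus R qinv λ'

    f : ℕ → K
    f = qfactInv R qinv

    L : Poly R → K
    L P = evalDeg R (Dqⁿ R q k P) n 1# - λ' * evalDeg R (Dqⁿ R q k P) n 0#

    L-linear : ∀ P a G M → IsLinearCombination P a G M → L P ≈ ∑ (λ l → a l * L (G l)) M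
    L-linear P a G M P≈ = begin
      L P                                           ≈⟨ +-cong (evalDeg-linear _ a DG M n 1# DP≈)
                                                              (-‿cong (*-cong refl (evalDeg-linear _ a DG M n 0# DP≈))) ⟩
      ∑ (value 1#) M - λ' * ∑ (value 0#) M          ≈⟨ +-cong refl (-‿cong (sumTo-*ˡ λ' (value 0#) M)) ⟨
      ∑ (value 1#) M - ∑ (λ l → λ' * value 0# l) M  ≈⟨ sumTo-- _ _ M ⟨
      ∑ (λ l → value 1# l - λ' * value 0# l) M      ≈⟨ sumTo-cong′ M (λ l → trans (+-cong refl (-‿cong (x∙yz≈y∙xz λ' (a l) _)))
                                                                             (sym (x[y-z]≈xy-xz (a l) _ _))) ⟩
      ∑ (λ l → a l * L (G l)) M                     ∎
      where
      DG : ℕ → Poly R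
      DG l = Dqⁿ R q k (G l)

      DP≈ : IsLinearCombination (Dqⁿ R q k P) a DG M
      DP≈ = Dqⁿ-linear q k P a G M P≈

      value : K → ℕ → K
      value x l = a l * evalDeg R (DG l) n x

    -- (1 − λ) x^m/[m]_q!, the coefficient of t^m in (1 − λ) e_q(xt)
    e : ℕ → Poly R
    e m i = μ * eqxt R qinv m i

    Dqⁿ-e : ∀ m i → Dqⁿ R q k (e m) i ≈ μ * (δ m (i ℕ.+ k) * f i)
    Dqⁿ-e m i = trans (Dqⁿ-coeff q k (e m) i) (qfall-e m)
      where
      qfall-e : ∀ m → qfall q k i * (μ * eqxt R qinv m (i ℕ.+ k)) ≈ μ * (δ m (i ℕ.+ k) * f i)
      qfall-e m with m ℕ.≟ i ℕ.+ k
      ... | yes ≡.refl = trans (x∙yz≈y∙xz _ μ _)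
                               (*-cong refl (trans (trans (*-comm _ _) (qfactInv-*-qfall k i)) (sym (*-identityˡ (f i)))))
      ... | no  _      = trans (*-cong refl (zeroʳ μ))
                               (trans (zeroʳ _) (sym (trans (*-cong refl (zeroˡ (f i))) (zeroʳ μ))))

    μδ-offdiag : ∀ {m j} x → m ≢ j → μ * (δ m j * x) ≈ 0#
    μδ-offdiag x m≢j = trans (*-cong refl (trans (*-cong (δ-offdiag m≢j) refl) (zeroˡ x))) (zeroʳ μ)

    evalDeg-Dqⁿ-e-zero : ∀ m → evalDeg R (Dqⁿ R q k (e m)) n 0# ≈ μ * (δ m k * 1#)
    evalDeg-Dqⁿ-e-zero m = trans (evalDeg-zero _ n) (Dqⁿ-e m 0)

    evalDeg-Dqⁿ-e-one-below : ∀ {m} → m < k → evalDeg R (Dqⁿ R q k (e m)) n 1# ≈ 0#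
    evalDeg-Dqⁿ-e-one-below {m} m<k = trans (evalDeg-one _ n) (sumTo-zero _ (suc n) (λ i _ →
      trans (Dqⁿ-e m i) (μδ-offdiag (f i) (ℕₚ.<⇒≢ (ℕₚ.<-≤-trans m<k (ℕₚ.m≤n+m k i))))))

    evalDeg-Dqⁿ-e-one-shift : ∀ r → r ≤ n → evalDeg R (Dqⁿ R q k (e (r ℕ.+ k))) n 1# ≈ μ * f r
    evalDeg-Dqⁿ-e-one-shift r r≤n = trans (evalDeg-one _ n) (trans
      (sumTo-single _ (suc n) r (s≤s r≤n) (λ i _ i≢r →
        trans (Dqⁿ-e (r ℕ.+ k) i) (μδ-offdiag (f i) (λ r+k≡i+k → i≢r (≡.sym (ℕₚ.+-cancelʳ-≡ k r i r+k≡i+k))))))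
      (trans (Dqⁿ-e (r ℕ.+ k) r) (*-cong refl (trans (*-cong (δ-diag (r ℕ.+ k)) refl) (*-identityˡ (f r))))))

    drop-λ'-term : ∀ {x y} → y ≈ 0# → x - λ' * y ≈ x
    drop-λ'-term {x} y≈0 = begin
      x - λ' * _   ≈⟨ +-cong refl (-‿cong (trans (*-cong refl y≈0) (zeroʳ λ'))) ⟩
      x - 0#       ≈⟨ +-cong refl ε⁻¹≈ε ⟩
      x + 0#       ≈⟨ +-identityʳ x ⟩
      x            ∎

    L-e-below : ∀ {m} → m < k → L (e m) ≈ 0#
    L-e-below {m} m<k = trans (drop-λ'-term (trans (evalDeg-Dqⁿ-e-zero m) (μδ-offdiag 1# (ℕₚ.<⇒≢ m<k))))
                              (evalDeg-Dqⁿ-e-one-below m<k)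

    L-e-shift : ∀ r → r ≤ n → L (e (r ℕ.+ k)) ≈ E r * μ
    L-e-shift zero    0≤n = begin
      L (e k)               ≈⟨ +-cong (trans (evalDeg-Dqⁿ-e-one-shift 0 0≤n) (*-comm μ 1#)) (-‿cong (*-cong refl ev₀≈μ)) ⟩
      1# * μ - λ' * μ       ≈⟨ [y-z]x≈yx-zx μ 1# λ' ⟨
      (1# - λ') * μ         ∎
      where
      ev₀≈μ : evalDeg R (Dqⁿ R q k (e k)) n 0# ≈ μ
      ev₀≈μ = trans (evalDeg-Dqⁿ-e-zero k)
                    (trans (*-cong refl (trans (*-cong (δ-diag k) refl) (*-identityˡ 1#))) (*-identityʳ μ))
    L-e-shift (suc r) r≤n =
      trans (drop-λ'-term (trans (evalDeg-Dqⁿ-e-zero (suc r ℕ.+ k))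
                                 (μδ-offdiag {suc r ℕ.+ k} 1# (λ eq → ℕₚ.m≢1+n+m k (≡.sym eq)))))
            (trans (evalDeg-Dqⁿ-e-one-shift (suc r) r≤n) (*-comm μ _))

    normL : ℕ → K
    normL j = f j * L (H j)

    conv-E-normL : ∀ m → conv E normL m ≈ L (e m)
    conv-E-normL m = sym (trans (L-linear (e m) _ (λ l → H (m ∸ l)) (suc m) e≈)
                                (sumTo-cong′ (suc m) (λ l → *-assoc _ _ _)))
      where
      e≈ : IsLinearCombination (e m) (λ l → E l * f (m ∸ l)) (λ l → H (m ∸ l)) (suc m)
      e≈ i = trans (sym (H-FE m i)) (sumTo-cong′ (suc m) (λ l →
               trans (*-cong refl (*-comm _ _)) (sym (*-assoc _ _ _))))

    L-e≈conv-δ : ∀ m → m ≤ n → L (e m) ≈ conv E (λ j → δ j k * μ) m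
    L-e≈conv-δ m m≤n with ℕₚ.<-≤-connex m k
    ... | inj₁ m<k = trans (L-e-below m<k) (sym (conv-δ-below E μ m<k))
    ... | inj₂ k≤m with m ∸ k | ℕₚ.m∸n+n≡m k≤m
    ...   | r | ≡.refl = trans (L-e-shift r (ℕₚ.≤-trans (ℕₚ.m≤m+n r k) m≤n)) (sym (conv-δ-shift E μ r k))

    L-H : ∀ j → j ≤ n → L (H j) ≈ qfact R q j * (δ j k * μ)
    L-H j j≤n = begin
      L (H j)                              ≈⟨ *-identityˡ _ ⟨
      1# * L (H j)                         ≈⟨ *-cong (qfact-*-qfactInv j) refl ⟨
      (qfact R q j * f j) * L (H j)        ≈⟨ *-assoc _ _ _ ⟩
      qfact R q j * normL j                ≈⟨ *-cong refl normL≈δ ⟩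
      qfact R q j * (δ j k * μ)            ∎
      where
      normL≈δ : normL j ≈ δ j k * μ
      normL≈δ = conv-injective {E = E} {normL} {λ j → δ j k * μ} u-inverse n
                  (λ m m≤n → trans (conv-E-normL m) (L-e≈conv-δ m m≤n)) j j≤n

    L-expansion : ∀ p C → IsLinearCombination p C H (suc n) → k ≤ n → L p ≈ C k * (qfact R q k * μ)
    L-expansion p C p≈ k≤n = begin
      L p                              ≈⟨ L-linear p C H (suc n) p≈ ⟩
      ∑ (λ j → C j * L (H j)) (suc n)  ≈⟨ sumTo-single _ (suc n) k (s≤s k≤n) off-diagonal ⟩
      C k * L (H k)                    ≈⟨ *-cong refl (L-H k k≤n) ⟩
      C k * (qfact R q k * (δ k k * μ)) ≈⟨ *-cong refl (*-cong refl (trans (*-cong (δ-diag k) refl) (*-identityˡ μ))) ⟩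
      C k * (qfact R q k * μ)          ∎
      where
      off-diagonal : ∀ j → j < suc n → j ≢ k → C j * L (H j) ≈ 0#
      off-diagonal j j<1+n j≢k = trans (*-cong refl (trans (L-H j (ℕₚ.m<1+n⇒m≤n j<1+n))
        (trans (*-cong refl (trans (*-cong (δ-offdiag j≢k) refl) (zeroˡ μ))) (zeroʳ _)))) (zeroʳ (C j))

open FrobeniusEuler using (module Expansion)

theorem2p5 : {c ℓ : Level} (R : CommutativeRing c ℓ) →
    let open CommutativeRing R renaming (Carrier to K) in
    (q : K) (qinv : ℕ → K) → (∀ m → qinv m * qint R q (suc m) ≈ 1#) →
    (λ' : K) (u : K) → u * (1# - λ') ≈ 1# →
    (H : ℕ → Poly R) → IsFrobeniusEuler R qinv λ' H →
    (n : ℕ) (p : Poly R) → DegLe R p n →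
    (C : ℕ → K) → (∀ i → p i ≈ sumTo R (λ k → C k * H k i) (suc n)) →
    ∀ k → k ≤ n →
      C k ≈ qfactInv R qinv k * u
              * (evalDeg R (Dqⁿ R q k p) n 1# - λ' * evalDeg R (Dqⁿ R q k p) n 0#)
theorem2p5 R q qinv qinv-inverse λ' u u-inverse H H-FE n p _ C p≈ k k≤n = begin
  C k                                                 ≈⟨ units-cancel (C k) (qfact-*-qfactInv k) u-inverse ⟩
  qfactInv R qinv k * u * (C k * (qfact R q k * μ))   ≈⟨ *-cong refl (L-expansion p C p≈ k≤n) ⟨
  qfactInv R qinv k * u * L p                         ∎
  where
  open CommutativeRing R
  open SetoidReasoning setoid
  open Units R using (units-cancel)
  open Expansion R q qinv qinv-inverse λ' u u-inverse H H-FE n k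
  open QCalculus.Inverses R q qinv qinv-inverse using (qfact-*-qfactInv)
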